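{- Let $P$ be a U-poset with a global minimum $\mathbf{0}$ and greatest element $\mathbf{1}$, with a U-coloring of its cover graph $D_P$ using colors $1,\ldots,k$, and let $\gamma$ be as defined below. Let $x\neq\mathbf{1}$ be an element of $P$ and let $C(x)$ be the set of colors of the arcs of $D_P$ leaving $x$. For every $i\in C(x)$ there is a unique maximal element $y_i$ such that $y_i\ge x$ and $\gamma_i(y_i)=\gamma_i(x)$. Moreover $y_i$ is meet-irreducible and $\gamma_j(y_i)>\gamma_j(x)$ for all $j\in C(x)\setminus\{i\}$.
   Context: For a digraph $D=(V,A)$, an arc coloring $c$ is a U-coloring if for all $u,v,w\in V$ with $u\neq w$ and $(v,u),(v,w)\in A$: (U$_1$) $c(v,u)\neq c(v,w)$; (U$_2$) there is $z\in V$ with arcs $(u,z),(w,z)\in A$ such that $c(v,u)=c(w,z)$ and $c(v,w)=c(u,z)$. A finite poset is a U-poset if the arcs of its cover graph $D_P$ (arc $(x,y)$ whenever $y$ covers $x$) admit a U-coloring; a U-poset with a global minimum also has a greatest element $\mathbf{1}$. $\gamma:P\to\mathbb{N}^k$ is defined by letting $\gamma_i(x)$ be the number of arcs of color $i$ on any directed $(\mathbf{0},x)$-path in $D_P$ (independent of the path). -}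

module Defs where

open import Level using (0ℓ)
open import Data.Nat using (ℕ; zero; suc; _<_)
open import Data.Fin using (Fin)
open import Data.Fin.Properties using () renaming (_≟_ to _≟ᶠ_)
open import Data.List using (List)
open import Data.List.Membership.Propositional using (_∈_)
open import Data.Product using (Σ; ∃; _×_; _,_)
open import Data.Empty using (⊥)
open import Relation.Nullary using (¬_; yes; no)
open import Relation.Binary.Core using (Rel)
open import Relation.Binary.Definitions using (Decidable)
open import Relation.Binary.Structures using (IsPartialOrder)
open import Relation.Binary.PropositionalEquality using (_≡_; _≢_)

record FinPoset : Set₁ where
  field
    Carrier        : Set
    _≤_            : Rel Carrier 0ℓ
    isPartialOrder : IsPartialOrder _≡_ _≤_
    _≤?_           : Decidable _≤_
    elements       : List Carrier
    complete       : ∀ x → x ∈ elements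

  infix 4 _<ₚ_ _⋖_

  _<ₚ_ : Rel Carrier 0ℓ
  x <ₚ y = x ≤ y × x ≢ y

  _⋖_ : Rel Carrier 0ℓ
  x ⋖ y = x <ₚ y × (∀ z → x <ₚ z → z <ₚ y → ⊥)

module _ (P : FinPoset) (k : ℕ) where
  open FinPoset P

  -- An arc colouring with colours Fin k (values on non-arcs are irrelevant).
  Colouring : Set
  Colouring = Carrier → Carrier → Fin k

  IsUColouring : Colouring → Set
  IsUColouring c =
    ∀ u v w → u ≢ w → v ⋖ u → v ⋖ w →
      (c v u ≢ c v w) ×
      (∃ λ z → (u ⋖ z) × (w ⋖ z) × (c v u ≡ c w z) × (c v w ≡ c u z))

  data Path : Carrier → Carrier → Set where
    []  : ∀ {x} → Path x x
    _∷_ : ∀ {x y z} → x ⋖ y → Path y z → Path x z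

  count : Colouring → Fin k → ∀ {x y} → Path x y → ℕ
  count c i []               = 0
  count c i (_∷_ {x} {y} _ p) with c x y ≟ᶠ i
  ... | yes _ = suc (count c i p)
  ... | no  _ = count c i p

  IsGamma : Colouring → Carrier → (Carrier → Fin k → ℕ) → Set
  IsGamma c bot γ = ∀ x (p : Path bot x) i → γ x i ≡ count c i p

  _∈C_ : Colouring → Fin k → Carrier → Set
  _∈C_ c i x = ∃ λ y → (x ⋖ y) × (c x y ≡ i)

  IsMaximal : (Carrier → Set) → Carrier → Set
  IsMaximal S y = S y × (∀ z → S z → y ≤ z → z ≡ y)

  -- meet-irreducible (finite poset): covered by exactly one element
  MeetIrreducible : Carrier → Set
  MeetIrreducible y = ∃ λ u → (y ⋖ u) × (∀ v → y ⋖ v → v ≡ u)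

-- The arcs of colour ≠ i are locally confluent: by (U2) two distinct arcs
-- v ⋖ u, v ⋖ w are closed by arcs u ⋖ z, w ⋖ z carrying the colours of v ⋖ w
-- and v ⋖ u, so no colour i appears. Since P is finite, Newman's argument makes
-- the colour-i-free paths confluent, so the level set {z ≥ x | γ_i z = γ_i x},
-- which is exactly the set of ends of colour-i-free paths from x, is directed
-- and has a greatest element y. Every cover of y then has colour i, so by (U1)
-- y has exactly one cover; an arc leaving x with colour j ≠ i stays in the level
-- set, so a path from x to y through it meets colour j.
module Submission where

open import Defs
open import Level using (0ℓ)
open import Data.Nat using (ℕ; suc; _+_; _<_; s≤s; z≤n) renaming (_≤_ to _≤ℕ_; _≟_ to _≟ℕ_)
open import Data.Nat.Properties using (≤∧≢⇒<; <⇒≢; m<m+n; +-identityʳ; 1+n≢0; +-cancelˡ-≡)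
open import Data.Nat.Induction using () renaming (<-wellFounded to <ℕ-wellFounded)
open import Data.Fin using (Fin)
open import Data.Fin.Properties using () renaming (_≟_ to _≟ᶠ_)
open import Data.List using ([]; _∷_; filter; length)
open import Data.List.Membership.Propositional using (_∈_; lose)
open import Data.List.Membership.Propositional.Properties using (∈-filter⁺; ∈-filter⁻)
open import Data.List.Relation.Unary.Any using (here; there; satisfied; any?)
open import Data.List.Relation.Binary.Pointwise as Pointwise using (Pointwise-≡⇒≡)
open import Data.List.Relation.Binary.Sublist.Heterogeneous using (Sublist)
open import Data.List.Relation.Binary.Sublist.Heterogeneous.Properties
  using (⊆-filter-Sublist; length-mono-≤; toPointwise; fromPointwise)
open import Data.Product using (∃; _×_; _,_; proj₁; proj₂)
open import Data.Empty using (⊥-elim)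
open import Function using (flip)
open import Induction.WellFounded using (WellFounded; Acc; acc; module Subrelation)
open import Relation.Binary.Construct.On as On using ()
open import Relation.Binary.Core using (Rel)
open import Relation.Binary.Definitions using (Decidable; DecidableEquality)
open import Relation.Binary.Structures using (IsPartialOrder)
open import Relation.Binary.PropositionalEquality using (_≡_; _≢_; refl; sym; trans; cong; subst; module ≡-Reasoning)
open import Relation.Nullary using (¬_; Dec; yes; no)
open import Relation.Nullary.Decidable using (_×-dec_; ¬?; map′)
open import Relation.Unary using (Pred) renaming (Decidable to Decidable₁)

module _ {A : Set} {P Q : Pred A 0ℓ} (P? : Decidable₁ P) (Q? : Decidable₁ Q)
         (P⇒Q : ∀ {a} → P a → Q a) where

  filter-⊆ : ∀ xs → Sublist _≡_ (filter P? xs) (filter Q? xs)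
  filter-⊆ xs = ⊆-filter-Sublist P? Q? (λ { refl → P⇒Q }) (fromPointwise (Pointwise.refl refl {xs}))

  length-filter-mono : ∀ xs → length (filter P? xs) ≤ℕ length (filter Q? xs)
  length-filter-mono xs = length-mono-≤ (filter-⊆ xs)

  length-filter-< : ∀ {a xs} → a ∈ xs → ¬ P a → Q a →
                    length (filter P? xs) < length (filter Q? xs)
  length-filter-< {a} {xs} a∈xs ¬Pa Qa = ≤∧≢⇒< (length-filter-mono xs) λ eq →
    let filters≡ = Pointwise-≡⇒≡ (toPointwise eq (filter-⊆ xs))
    in ¬Pa (proj₂ (∈-filter⁻ P? {xs = xs} (subst (a ∈_) (sym filters≡) (∈-filter⁺ Q? a∈xs Qa))))

module _ (P : FinPoset) where
  open FinPoset P
  open IsPartialOrder isPartialOrder using (antisym) renaming (refl to ≤-refl; trans to ≤-trans)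

  _>ₚ_ : Rel Carrier 0ℓ
  _>ₚ_ = flip _<ₚ_

  <ₚ⇒≱ : ∀ {x y} → x <ₚ y → ¬ y ≤ x
  <ₚ⇒≱ (x≤y , x≢y) y≤x = x≢y (antisym x≤y y≤x)

  _≟_ : DecidableEquality Carrier
  x ≟ y with x ≤? y | y ≤? x
  ... | yes x≤y | yes y≤x = yes (antisym x≤y y≤x)
  ... | no  x≰y | _       = no λ { refl → x≰y ≤-refl }
  ... | yes _   | no  y≰x = no λ { refl → y≰x ≤-refl }

  _<?_ : Decidable _<ₚ_
  x <? y = (x ≤? y) ×-dec ¬? (x ≟ y)

  #above #below : Carrier → ℕ
  #above x = length (filter (x ≤?_) elements)
  #below x = length (filter (_≤? x) elements)

  #above-< : ∀ {x y} → x <ₚ y → #above y < #above x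
  #above-< {x} {y} x<y = length-filter-< (y ≤?_) (x ≤?_) (≤-trans (proj₁ x<y))
    (complete x) (<ₚ⇒≱ x<y) ≤-refl

  #below-< : ∀ {x y} → x <ₚ y → #below x < #below y
  #below-< {x} {y} x<y = length-filter-< (_≤? x) (_≤? y) (λ z≤x → ≤-trans z≤x (proj₁ x<y))
    (complete y) (<ₚ⇒≱ x<y) ≤-refl

  <ₚ-wellFounded : WellFounded _<ₚ_
  <ₚ-wellFounded = Subrelation.wellFounded #below-< (On.wellFounded #below <ℕ-wellFounded)

  >ₚ-wellFounded : WellFounded _>ₚ_
  >ₚ-wellFounded = Subrelation.wellFounded #above-< (On.wellFounded #above <ℕ-wellFounded)

  between? : ∀ x y → Dec (∃ λ z → x <ₚ z × z <ₚ y)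
  between? x y = map′ satisfied (λ (z , x<z<y) → lose (complete z) x<z<y)
    (any? (λ z → (x <? z) ×-dec (z <? y)) elements)

  cover-below : ∀ {x y} → Acc _<ₚ_ y → x <ₚ y → ∃ λ z → x ⋖ z × z ≤ y
  cover-below {x} {y} (acc rs) x<y with between? x y
  ... | no  nothing-between = y , (x<y , λ z x<z z<y → nothing-between (z , x<z , z<y)) , ≤-refl
  ... | yes (z , x<z , z<y) with cover-below (rs z<y) x<z
  ...   | w , x⋖w , w≤z = w , x⋖w , ≤-trans w≤z (proj₁ z<y)

  module _ {S : Pred Carrier 0ℓ} (S? : Decidable₁ S)
           (directed : ∀ {a b} → S a → S b → ∃ λ z → S z × a ≤ z × b ≤ z) where

    directed⇒greatest : ∀ {x} → S x → ∃ λ y → S y × (∀ z → S z → z ≤ y)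
    directed⇒greatest {x} Sx = let (y , Sy , ub) = upper-bound elements
                               in y , Sy , λ z Sz → ub (complete z) Sz
      where
      upper-bound : ∀ zs → ∃ λ y → S y × (∀ {z} → z ∈ zs → S z → z ≤ y)
      upper-bound []       = x , Sx , λ ()
      upper-bound (z ∷ zs) with upper-bound zs | S? z
      ... | y , Sy , ub | no ¬Sz = y , Sy , λ { (here refl) Sz → ⊥-elim (¬Sz Sz) ; (there w∈zs) → ub w∈zs }
      ... | y , Sy , ub | yes Sz with directed Sy Sz
      ...   | y′ , Sy′ , y≤y′ , z≤y′ =
        y′ , Sy′ , λ { (here refl) _ → z≤y′ ; (there w∈zs) Sw → ≤-trans (ub w∈zs Sw) y≤y′ }

  module _ (k : ℕ) where

    module _ {S : Pred Carrier 0ℓ} {y : Carrier} (Sy : S y) (greatest : ∀ z → S z → z ≤ y) where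

      greatest⇒maximal : IsMaximal P k S y
      greatest⇒maximal = Sy , λ z Sz y≤z → antisym (greatest z Sz) y≤z

      maximal⇒≡greatest : ∀ {y′} → IsMaximal P k S y′ → y′ ≡ y
      maximal⇒≡greatest (Sy′ , maximal) = sym (maximal y Sy (greatest _ Sy′))

    infixr 5 _++ᵖ_

    _++ᵖ_ : ∀ {x y z} → Path P k x y → Path P k y z → Path P k x z
    []         ++ᵖ q = q
    (x⋖y ∷ p) ++ᵖ q = x⋖y ∷ (p ++ᵖ q)

    path⇒≤ : ∀ {x y} → Path P k x y → x ≤ y
    path⇒≤ []         = ≤-refl
    path⇒≤ (x⋖y ∷ p) = ≤-trans (proj₁ (proj₁ x⋖y)) (path⇒≤ p)

    ≤⇒path : ∀ {x y} → x ≤ y → Path P k x y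
    ≤⇒path {x} x≤y = go (>ₚ-wellFounded x) x≤y
      where
      go : ∀ {x y} → Acc _>ₚ_ x → x ≤ y → Path P k x y
      go {x} {y} (acc rs) x≤y with x ≟ y
      ... | yes refl = []
      ... | no  x≢y with cover-below (<ₚ-wellFounded y) (x≤y , x≢y)
      ...   | z , x⋖z , z≤y = x⋖z ∷ go (rs (proj₁ x⋖z)) z≤y

    module _ (c : Colouring P k) where

      count-++ : ∀ j {x y z} (p : Path P k x y) (q : Path P k y z) →
                 count P k c j (p ++ᵖ q) ≡ count P k c j p + count P k c j q
      count-++ j []                  q = refl
      count-++ j (_∷_ {x} {y} _ p) q with c x y ≟ᶠ j
      ... | yes _ = cong suc (count-++ j p q)
      ... | no  _ = count-++ j p q

      count-∷-colour : ∀ {j x y z} (x⋖y : x ⋖ y) (p : Path P k y z) → c x y ≡ j →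
                       count P k c j (x⋖y ∷ p) ≡ suc (count P k c j p)
      count-∷-colour {j} {x} {y} _ _ cxy≡j with c x y ≟ᶠ j
      ... | yes _    = refl
      ... | no  cxy≢j = ⊥-elim (cxy≢j cxy≡j)

      data Avoiding (i : Fin k) : Carrier → Carrier → Set where
        []     : ∀ {x} → Avoiding i x x
        _∷⟨_⟩_ : ∀ {x y z} → x ⋖ y → c x y ≢ i → Avoiding i y z → Avoiding i x z

      infixr 5 _∷⟨_⟩_

      module _ {i : Fin k} where

        toPath : ∀ {x y} → Avoiding i x y → Path P k x y
        toPath []               = []
        toPath (x⋖y ∷⟨ _ ⟩ p) = x⋖y ∷ toPath p

        count-toPath : ∀ {x y} (p : Avoiding i x y) → count P k c i (toPath p) ≡ 0
        count-toPath [] = refl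
        count-toPath (_∷⟨_⟩_ {x} {y} _ cxy≢i p) with c x y ≟ᶠ i
        ... | yes cxy≡i = ⊥-elim (cxy≢i cxy≡i)
        ... | no  _     = count-toPath p

        count≡0⇒avoiding : ∀ {x y} (p : Path P k x y) → count P k c i p ≡ 0 → Avoiding i x y
        count≡0⇒avoiding []                    _ = []
        count≡0⇒avoiding (_∷_ {x} {y} x⋖y p) #i≡0 with c x y ≟ᶠ i
        ... | yes _     = ⊥-elim (1+n≢0 #i≡0)
        ... | no cxy≢i = x⋖y ∷⟨ cxy≢i ⟩ count≡0⇒avoiding p #i≡0

        avoiding⇒≤ : ∀ {x y} → Avoiding i x y → x ≤ y
        avoiding⇒≤ p = path⇒≤ (toPath p)

        infixr 5 _++ᵃ_

        _++ᵃ_ : ∀ {x y z} → Avoiding i x y → Avoiding i y z → Avoiding i x z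
        []                   ++ᵃ q = q
        (x⋖y ∷⟨ cxy≢i ⟩ p) ++ᵃ q = x⋖y ∷⟨ cxy≢i ⟩ (p ++ᵃ q)

        Joinable : Carrier → Carrier → Set
        Joinable a b = ∃ λ z → Avoiding i a z × Avoiding i b z

        avoiding-confluent : IsUColouring P k c → ∀ {v a b} → Acc _>ₚ_ v →
                             Avoiding i v a → Avoiding i v b → Joinable a b
        avoiding-confluent U _ []  q  = _ , q , []
        avoiding-confluent U _ p   [] = _ , [] , p
        avoiding-confluent U {v} (acc rs) (_∷⟨_⟩_ {y = u} v⋖u cvu≢i p) (_∷⟨_⟩_ {y = w} v⋖w cvw≢i q)
          with u ≟ w
        ... | yes refl = avoiding-confluent U (rs (proj₁ v⋖u)) p q
        ... | no  u≢w  with proj₂ (U u v w u≢w v⋖u v⋖w)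
        ...   | z , u⋖z , w⋖z , cvu≡cwz , cvw≡cuz
          with avoiding-confluent U (rs (proj₁ v⋖u)) p
                 (u⋖z ∷⟨ (λ cuz≡i → cvw≢i (trans cvw≡cuz cuz≡i)) ⟩ [])
        ...   | a′ , a⇝a′ , z⇝a′
          with avoiding-confluent U (rs (proj₁ v⋖w)) q
                 (w⋖z ∷⟨ (λ cwz≡i → cvu≢i (trans cvu≡cwz cwz≡i)) ⟩ z⇝a′)
        ...   | b′ , b⇝b′ , a′⇝b′ = b′ , a⇝a′ ++ᵃ a′⇝b′ , b⇝b′

      all-covers-coloured⇒meetIrreducible :
        IsUColouring P k c → ∀ {i y top} → y <ₚ top → (∀ v → y ⋖ v → c y v ≡ i) →
        MeetIrreducible P k y
      all-covers-coloured⇒meetIrreducible U {y = y} {top} y<top coloured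
        with cover-below (<ₚ-wellFounded top) y<top
      ... | u , y⋖u , _ = u , y⋖u , unique
        where
        unique : ∀ v → y ⋖ v → v ≡ u
        unique v y⋖v with v ≟ u
        ... | yes v≡u = v≡u
        ... | no  v≢u = ⊥-elim (proj₁ (U v y u v≢u y⋖v y⋖u)
                                       (trans (coloured v y⋖v) (sym (coloured u y⋖u))))

      module _ {bot : Carrier} (bot-least : ∀ x → bot ≤ x)
               {γ : Carrier → Fin k → ℕ} (isγ : IsGamma P k c bot γ) where

        γ-path : ∀ j {x y} (p : Path P k x y) → γ y j ≡ γ x j + count P k c j p
        γ-path j {x} {y} p = begin
          γ y j                                            ≡⟨ isγ y (bot⇝x ++ᵖ p) j ⟩
          count P k c j (bot⇝x ++ᵖ p)                     ≡⟨ count-++ j bot⇝x p ⟩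
          count P k c j bot⇝x + count P k c j p           ≡⟨ cong (_+ _) (isγ x bot⇝x j) ⟨
          γ x j + count P k c j p                          ∎
          where
          open ≡-Reasoning
          bot⇝x : Path P k bot x
          bot⇝x = ≤⇒path (bot-least x)

        γ-<-via-arc : ∀ {j x w y} → x ⋖ w → c x w ≡ j → w ≤ y → γ x j < γ y j
        γ-<-via-arc {j} {x} x⋖w cxw≡j w≤y =
          subst (γ x j <_) (sym γy≡) (m<m+n (γ x j) (s≤s z≤n))
          where
          w⇝y = ≤⇒path w≤y
          γy≡ : γ _ j ≡ γ x j + suc (count P k c j w⇝y)
          γy≡ = trans (γ-path j (x⋖w ∷ w⇝y)) (cong (γ x j +_) (count-∷-colour x⋖w w⇝y cxw≡j))

        SameLevel : Fin k → Carrier → Carrier → Set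
        SameLevel i x z = x ≤ z × γ z i ≡ γ x i

        module _ {i : Fin k} {x : Carrier} where

          avoiding⇒sameLevel : ∀ {z} → Avoiding i x z → SameLevel i x z
          avoiding⇒sameLevel x⇝z = avoiding⇒≤ x⇝z ,
            trans (γ-path i (toPath x⇝z)) (trans (cong (γ x i +_) (count-toPath x⇝z)) (+-identityʳ _))

          sameLevel⇒avoiding : ∀ {z} → SameLevel i x z → Avoiding i x z
          sameLevel⇒avoiding (x≤z , γz≡γx) = count≡0⇒avoiding x⇝z
            (+-cancelˡ-≡ (γ x i) _ 0 (trans (sym (γ-path i x⇝z)) (trans γz≡γx (sym (+-identityʳ _)))))
            where
            x⇝z = ≤⇒path x≤z

        module LevelSet (U : IsUColouring P k c) (i : Fin k) (x : Carrier) where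

          sameLevel? : Decidable₁ (SameLevel i x)
          sameLevel? z = (x ≤? z) ×-dec (γ z i ≟ℕ γ x i)

          sameLevel-directed : ∀ {a b} → SameLevel i x a → SameLevel i x b →
                               ∃ λ z → SameLevel i x z × a ≤ z × b ≤ z
          sameLevel-directed La Lb
            with avoiding-confluent U (>ₚ-wellFounded x) (sameLevel⇒avoiding La) (sameLevel⇒avoiding Lb)
          ... | z , a⇝z , b⇝z =
            z , avoiding⇒sameLevel (sameLevel⇒avoiding La ++ᵃ a⇝z) , avoiding⇒≤ a⇝z , avoiding⇒≤ b⇝z

          sameLevel-greatest : ∃ λ y → SameLevel i x y × (∀ z → SameLevel i x z → z ≤ y)
          sameLevel-greatest = directed⇒greatest sameLevel? sameLevel-directed (≤-refl , refl)

          sameLevel-<-top : _∈C_ P k c i x → ∀ {top} → (∀ z → z ≤ top) →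
                            ∀ {y} → SameLevel i x y → y <ₚ top
          sameLevel-<-top (w , x⋖w , cxw≡i) top-greatest {y} (_ , γy≡γx) =
            top-greatest y , λ { refl → <⇒≢ (γ-<-via-arc x⋖w cxw≡i (top-greatest w)) (sym γy≡γx) }

          module _ {y : Carrier} (Ly : SameLevel i x y) (greatest : ∀ z → SameLevel i x z → z ≤ y) where

            covers-of-greatest-coloured : ∀ v → y ⋖ v → c y v ≡ i
            covers-of-greatest-coloured v y⋖v with c y v ≟ᶠ i
            ... | yes cyv≡i = cyv≡i
            ... | no  cyv≢i = ⊥-elim (<ₚ⇒≱ (proj₁ y⋖v) (greatest v Lv))
              where
              Lv : SameLevel i x v
              Lv = avoiding⇒sameLevel (sameLevel⇒avoiding Ly ++ᵃ (y⋖v ∷⟨ cyv≢i ⟩ []))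

            γ-<-greatest : ∀ j → _∈C_ P k c j x → j ≢ i → γ x j < γ y j
            γ-<-greatest j (w , x⋖w , cxw≡j) j≢i = γ-<-via-arc x⋖w cxw≡j (greatest w Lw)
              where
              Lw : SameLevel i x w
              Lw = avoiding⇒sameLevel (x⋖w ∷⟨ (λ cxw≡i → j≢i (trans (sym cxw≡j) cxw≡i)) ⟩ [])

lemma4 : (P : FinPoset) (k : ℕ) (c : Colouring P k) → IsUColouring P k c →
    (bot top : FinPoset.Carrier P) →
    (∀ x → FinPoset._≤_ P bot x) → (∀ x → FinPoset._≤_ P x top) →
    (γ : FinPoset.Carrier P → Fin k → ℕ) → IsGamma P k c bot γ →
    (x : FinPoset.Carrier P) → x ≢ top →
    (i : Fin k) → _∈C_ P k c i x →
    ∃ λ y →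
      IsMaximal P k (λ z → FinPoset._≤_ P x z × γ z i ≡ γ x i) y ×
      (∀ y′ → IsMaximal P k (λ z → FinPoset._≤_ P x z × γ z i ≡ γ x i) y′ → y′ ≡ y) ×
      MeetIrreducible P k y ×
      (∀ j → _∈C_ P k c j x → j ≢ i → γ x j < γ y j)
lemma4 P k c U bot top bot-least top-greatest γ isγ x _ i i∈Cx =
  let open LevelSet P k c bot-least isγ U i x
      (y , Ly , greatest) = sameLevel-greatest
  in  y ,
      greatest⇒maximal P k Ly greatest ,
      (λ y′ → maximal⇒≡greatest P k Ly greatest) ,
      all-covers-coloured⇒meetIrreducible P k c U (sameLevel-<-top i∈Cx top-greatest Ly)
        (covers-of-greatest-coloured Ly greatest) ,
      γ-<-greatest Ly greatest
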